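{- Let $t\ge 2$ and let $G$ be a $t$-connected chordal graph with threshold function $\theta$ satisfying $\theta(x)\le t$ for all vertices $x$. If $S\subseteq V(G)$ induces a complete subgraph of $G$ with $|S|=t$, then $[S]^G_\theta=V(G)$, i.e. the target set $S$ influences all vertices in $(G,\theta)$.
   Context: A graph is chordal if it has no induced cycle of length greater than three. For a finite simple graph $G$ with threshold function $\theta:V(G)\to\mathbb{Z}$ and a target set $S\subseteq V(G)$, the activation process is: at time $0$ the vertices of $S$ are active and all others inactive; at each subsequent time step, every inactive vertex $u$ having at least $\theta(u)$ active neighbours becomes active. The process stops when no more vertices become active; $[S]^G_\theta$ denotes the set of active vertices at the end. -}

module Defs where

open import Data.Nat using (ℕ; zero; suc; _+_; _<_; _≤_; _%_)
open import Data.Bool using (Bool; true; false)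
open import Data.Fin using (Fin; toℕ)
open import Data.Fin.Subset using (Subset; _∈_; _∉_; _∪_; _∩_; ∣_∣)
open import Data.Vec using (tabulate)
open import Data.Integer using (ℤ; +_; _≤?_)
open import Data.Product using (Σ; ∃; _×_)
open import Data.Sum using (_⊎_)
open import Relation.Nullary using (¬_)
open import Relation.Nullary.Decidable using (⌊_⌋)
open import Relation.Binary.PropositionalEquality using (_≡_; _≢_)
open import Function.Definitions using (Injective)

record Graph (n : ℕ) : Set where
  field
    Adj    : Fin n → Fin n → Bool
    sym    : ∀ u v → Adj u v ≡ Adj v u
    irrefl : ∀ v → Adj v v ≡ false
open Graph public

module _ {n : ℕ} (G : Graph n) where

  N : Fin n → Subset n
  N u = tabulate (Adj G u)

  data PathAvoiding (X : Subset n) : Fin n → Fin n → Set where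
    here : ∀ {u} → u ∉ X → PathAvoiding X u u
    step : ∀ {u w v} → u ∉ X → Adj G u w ≡ true →
           PathAvoiding X w v → PathAvoiding X u v

  ConnectedWithout : Subset n → Set
  ConnectedWithout X = ∀ u v → u ∉ X → v ∉ X → PathAvoiding X u v

  Connected : ℕ → Set
  Connected t = (t < n) × (∀ (X : Subset n) → ∣ X ∣ < t → ConnectedWithout X)

  CycNext : {k : ℕ} → Fin k → Fin k → Set
  CycNext {zero}  i j = toℕ j ≡ 0
  CycNext {suc k} i j = toℕ j ≡ (toℕ i + 1) % suc k

  InducedCycle : (k : ℕ) → (Fin k → Fin n) → Set
  InducedCycle k c = Injective _≡_ _≡_ c ×
    (∀ i j → (Adj G (c i) (c j) ≡ true) → (CycNext i j ⊎ CycNext j i)) ×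
    (∀ i j → (CycNext i j ⊎ CycNext j i) → Adj G (c i) (c j) ≡ true)

  Chordal : Set
  Chordal = ∀ k → 3 < k → ∀ (c : Fin k → Fin n) → ¬ InducedCycle k c

  IsClique : Subset n → Set
  IsClique S = ∀ u v → u ∈ S → v ∈ S → u ≢ v → Adj G u v ≡ true

  active : (θ : Fin n → ℤ) → Subset n → ℕ → Subset n
  active θ S zero    = S
  active θ S (suc k) = active θ S k ∪
    tabulate (λ u → ⌊ θ u ≤? + ∣ N u ∩ active θ S k ∣ ⌋)

  _∈closure_,_ : Fin n → (Fin n → ℤ) → Subset n → Set
  v ∈closure θ , S = ∃ λ k → v ∈ active θ S k

  Influences : (Fin n → ℤ) → Subset n → Set
  Influences θ S = ∀ v → v ∈closure θ , S

module Submission where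

-- The final active set A of the process is θ-closed: every vertex with at
-- least θ neighbours in A belongs to A.  It therefore suffices to show that a
-- θ-closed set A containing a clique K with |K| ≥ t is everything.  Suppose
-- x ∉ A; let C be the component of x in G − K and B ⊆ K the vertices of K
-- adjacent to C.  B separates x from K ∖ B, so t-connectivity gives |B| ≥ t.
-- Chordality gives a vertex c ∈ C adjacent to all of B (CommonNeighbour); then
-- c has ≥ t ≥ θ(c) neighbours in A, so c ∈ A, and B ∪ {c} is a clique of size
-- ≥ t inside A whose component around x is strictly smaller than C.  Induction
-- on |C| gives a contradiction.

open import Defs
open import Data.Nat using (ℕ; _≤_)
open import Data.Fin using (Fin)
open import Data.Fin.Subset using (Subset; ∣_∣)
open import Data.Integer using (ℤ; +_) renaming (_≤_ to _≤ℤ_)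
open import Data.Integer as ℤ using (+≤+)
import Data.Integer.Properties as ℤP
open import Relation.Binary.PropositionalEquality using (_≡_)

open import Data.Nat using (zero; suc; _<_; _+_; _%_; z≤n; s≤s)
import Data.Nat.Properties as ℕP
import Data.Nat.DivMod as DM
open import Data.Bool using (Bool; true) renaming (_≟_ to _≟ᵇ_)
open import Data.Bool.Properties using (T-≡)
open import Data.Fin using (zero; suc; toℕ; fromℕ; _≟_)
import Data.Fin.Properties as FinP
open import Data.Fin.Subset using (_∈_; _∉_; _∪_; _∩_; ⁅_⁆; _⊆_)
import Data.Fin.Subset.Properties as SubP
open import Data.Vec using (tabulate)
import Data.Vec.Properties as VecP
open import Data.Product using (Σ; ∃; _×_; _,_; proj₁; proj₂)
open import Data.Sum using (_⊎_; inj₁; inj₂; swap) renaming (map to ⊎-map)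
open import Data.Empty using (⊥; ⊥-elim)
open import Data.Unit using (⊤)
open import Function using (_∘_)
open import Function.Definitions using (Injective)
open import Function.Bundles using (Equivalence)
open import Relation.Nullary using (¬_; Dec; yes; no; contradiction)
open import Relation.Nullary.Decidable using (⌊_⌋; toWitness; fromWitness; ¬?; _×-dec_; _→-dec_)
import Relation.Unary as U
open import Relation.Binary.PropositionalEquality using (_≢_; refl; trans; cong; subst) renaming (sym to ≡-sym)

module _ {n : ℕ} where

  ∈-tabulate⁺ : {f : Fin n → Bool} {x : Fin n} → f x ≡ true → x ∈ tabulate f
  ∈-tabulate⁺ {f} {x} fx = VecP.lookup⇒[]= x (tabulate f) (trans (VecP.lookup∘tabulate f x) fx)

  ∈-tabulate⁻ : {f : Fin n → Bool} {x : Fin n} → x ∈ tabulate f → f x ≡ true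
  ∈-tabulate⁻ {f} {x} x∈ = trans (≡-sym (VecP.lookup∘tabulate f x)) (VecP.[]=⇒lookup x∈)

  select : {P : Fin n → Set} → U.Decidable P → Subset n
  select P? = tabulate (λ x → ⌊ P? x ⌋)

  ∈-select⁺ : {P : Fin n → Set} (P? : U.Decidable P) {x : Fin n} → P x → x ∈ select P?
  ∈-select⁺ P? {x} px = ∈-tabulate⁺ (Equivalence.to T-≡ (fromWitness {a? = P? x} px))

  ∈-select⁻ : {P : Fin n → Set} (P? : U.Decidable P) {x : Fin n} → x ∈ select P? → P x
  ∈-select⁻ P? {x} x∈ = toWitness {a? = P? x} (Equivalence.from T-≡ (∈-tabulate⁻ x∈))

  ⊈-witness : (p q : Subset n) → ¬ (q ⊆ p) → ∃ λ x → x ∈ q × x ∉ p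
  ⊈-witness p q q⊈p
    with FinP.¬∀⟶∃¬ n (λ x → x ∈ q → x ∈ p) (λ x → (x SubP.∈? q) →-dec (x SubP.∈? p)) (λ q⊆p → q⊈p (q⊆p _))
  ... | x , ¬[x∈q→x∈p] with x SubP.∈? q
  ...   | yes x∈q = x , x∈q , λ x∈p → ¬[x∈q→x∈p] (λ _ → x∈p)
  ...   | no  x∉q = ⊥-elim (¬[x∈q→x∈p] (λ x∈q → contradiction x∈q x∉q))

  ∪⁅⁆-⊆ : {p q : Subset n} {y : Fin n} → p ⊆ q → y ∈ q → p ∪ ⁅ y ⁆ ⊆ q
  ∪⁅⁆-⊆ {p} {y = y} p⊆q y∈q x∈ with SubP.x∈p∪q⁻ p ⁅ y ⁆ x∈
  ... | inj₁ x∈p = p⊆q x∈p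
  ... | inj₂ x∈y with SubP.x∈⁅y⁆⇒x≡y y x∈y
  ...   | refl = y∈q

  ∉-∪⁅⁆ : {p : Subset n} {x y : Fin n} → x ∉ p → x ≢ y → x ∉ p ∪ ⁅ y ⁆
  ∉-∪⁅⁆ {p} {y = y} x∉p x≢y x∈ with SubP.x∈p∪q⁻ p ⁅ y ⁆ x∈
  ... | inj₁ x∈p = x∉p x∈p
  ... | inj₂ x∈y = x≢y (SubP.x∈⁅y⁆⇒x≡y y x∈y)

-- Iterating X ↦ X ∪ g X on subsets of a finite set becomes stationary: some
-- stage is closed under g.  Both the activation process and the connected
-- components below are obtained this way.
module Stages {n : ℕ} (g : Subset n → Subset n) where

  stage : Subset n → ℕ → Subset n
  stage X zero    = X
  stage X (suc k) = stage X k ∪ g (stage X k)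

  ClosedStage : Subset n → Set
  ClosedStage X = ∃ λ k → g (stage X k) ⊆ stage X k

  stage-⊇ : ∀ X k → X ⊆ stage X k
  stage-⊇ X zero    x∈ = x∈
  stage-⊇ X (suc k) x∈ = SubP.p⊆p∪q (g (stage X k)) (stage-⊇ X k x∈)

  -- As long as no stage is closed, every stage adds a new element.
  closed-or-large : ∀ X m → ClosedStage X ⊎ m ≤ ∣ stage X m ∣
  closed-or-large X zero = inj₂ z≤n
  closed-or-large X (suc m) with closed-or-large X m
  ... | inj₁ closed = inj₁ closed
  ... | inj₂ large with g (stage X m) SubP.⊆? stage X m
  ...   | yes closed = inj₁ (m , closed)
  ...   | no  open′ with ⊈-witness (stage X m) (g (stage X m)) open′
  ...     | x , x∈g , x∉stage = inj₂ (ℕP.≤-<-trans large (SubP.p⊂q⇒∣p∣<∣q∣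
              (SubP.p⊆p∪q (g (stage X m)) , x , SubP.q⊆p∪q (stage X m) (g (stage X m)) x∈g , x∉stage)))

  stabilises : ∀ X → ClosedStage X
  stabilises X with closed-or-large X (suc n)
  ... | inj₁ closed = closed
  ... | inj₂ large  = contradiction (SubP.∣p∣≤n (stage X (suc n))) (ℕP.<⇒≱ large)

module Walks {n : ℕ} (G : Graph n) where

  infix 4 _~_ _∈ʷ_ _⊆ʷ_
  infixr 5 _∷⟨_⟩_ _++_

  _~_ : Fin n → Fin n → Set
  u ~ v = Adj G u v ≡ true

  _~?_ : ∀ u v → Dec (u ~ v)
  u ~? v = Adj G u v ≟ᵇ true

  ~-sym : ∀ {u v} → u ~ v → v ~ u
  ~-sym {u} {v} u~v = trans (Graph.sym G v u) u~v

  ~-irrefl : ∀ {u v} → u ~ v → u ≢ v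
  ~-irrefl {u} u~u refl with trans (≡-sym u~u) (irrefl G u)
  ... | ()

  IsClique-extend : ∀ {B c} → IsClique G B → (∀ b → b ∈ B → c ~ b) → IsClique G (B ∪ ⁅ c ⁆)
  IsClique-extend {B} {c} B-clique c~B u v u∈ v∈ u≢v
    with SubP.x∈p∪q⁻ B ⁅ c ⁆ u∈ | SubP.x∈p∪q⁻ B ⁅ c ⁆ v∈
  ... | inj₁ u∈B | inj₁ v∈B = B-clique u v u∈B v∈B u≢v
  ... | inj₁ u∈B | inj₂ v∈c rewrite SubP.x∈⁅y⁆⇒x≡y c v∈c = ~-sym (c~B u u∈B)
  ... | inj₂ u∈c | inj₁ v∈B rewrite SubP.x∈⁅y⁆⇒x≡y c u∈c = c~B v v∈B
  ... | inj₂ u∈c | inj₂ v∈c =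
    contradiction (trans (SubP.x∈⁅y⁆⇒x≡y c u∈c) (≡-sym (SubP.x∈⁅y⁆⇒x≡y c v∈c))) u≢v

  data Walk : Fin n → Fin n → Set where
    [_]    : ∀ x → Walk x x
    _∷⟨_⟩_ : ∀ x {w y} → x ~ w → Walk w y → Walk x y

  length : ∀ {x y} → Walk x y → ℕ
  length [ x ]        = 0
  length (x ∷⟨ e ⟩ p) = suc (length p)

  _∈ʷ_ : ∀ {x y} → Fin n → Walk x y → Set
  v ∈ʷ [ x ]        = v ≡ x
  v ∈ʷ (x ∷⟨ e ⟩ p) = v ≡ x ⊎ v ∈ʷ p

  _⊆ʷ_ : ∀ {x y a b} → Walk x y → Walk a b → Set
  p ⊆ʷ q = ∀ v → v ∈ʷ p → v ∈ʷ q

  Allʷ : ∀ {x y} → (Fin n → Set) → Walk x y → Set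
  Allʷ P p = ∀ v → v ∈ʷ p → P v

  AllButFirst : ∀ {x y} → (Fin n → Set) → Walk x y → Set
  AllButFirst P [ x ]        = ⊤
  AllButFirst P (x ∷⟨ e ⟩ p) = Allʷ P p

  AllButLast : ∀ {x y} → (Fin n → Set) → Walk x y → Set
  AllButLast P [ x ]        = ⊤
  AllButLast P (x ∷⟨ e ⟩ p) = P x × AllButLast P p

  head-∈ʷ : ∀ {x y} (p : Walk x y) → x ∈ʷ p
  head-∈ʷ [ x ]        = refl
  head-∈ʷ (x ∷⟨ e ⟩ p) = inj₁ refl

  last-∈ʷ : ∀ {x y} (p : Walk x y) → y ∈ʷ p
  last-∈ʷ [ x ]        = refl
  last-∈ʷ (x ∷⟨ e ⟩ p) = inj₂ (last-∈ʷ p)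

  AllButFirst-use : ∀ {P : Fin n → Set} {x y} (p : Walk x y) → AllButFirst P p →
                    ∀ v → v ∈ʷ p → v ≢ x → P v
  AllButFirst-use [ x ]        _    v v∈ v≢x = contradiction v∈ v≢x
  AllButFirst-use (x ∷⟨ e ⟩ p) Pp v (inj₁ v≡x) v≢x = contradiction v≡x v≢x
  AllButFirst-use (x ∷⟨ e ⟩ p) Pp v (inj₂ v∈p) v≢x = Pp v v∈p

  AllButLast-head : ∀ {P : Fin n → Set} {x y} (p : Walk x y) → AllButLast P p → x ≢ y → P x
  AllButLast-head [ x ]        _        x≢x = contradiction refl x≢x
  AllButLast-head (x ∷⟨ e ⟩ p) (Px , _) _   = Px

  PathAvoiding⇒Walk : ∀ {X u v} → PathAvoiding G X u v → Σ (Walk u v) (Allʷ (_∉ X))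
  PathAvoiding⇒Walk (here u∉X) = [ _ ] , λ { v refl → u∉X }
  PathAvoiding⇒Walk (step u∉X u~w rest) with PathAvoiding⇒Walk rest
  ... | p , p∉X = _ ∷⟨ u~w ⟩ p , λ { v (inj₁ refl) → u∉X ; v (inj₂ v∈p) → p∉X v v∈p }

  length-≥2 : ∀ {x y} (p : Walk x y) → x ≢ y → ¬ x ~ y → 2 ≤ length p
  length-≥2 [ x ]                       x≢y _   = contradiction refl x≢y
  length-≥2 (x ∷⟨ x~y ⟩ [ y ])            _   x≁y = contradiction x~y x≁y
  length-≥2 (x ∷⟨ _ ⟩ w ∷⟨ _ ⟩ p) _   _   = s≤s (s≤s z≤n)

  _++_ : ∀ {x y z} → Walk x y → Walk y z → Walk x z
  [ x ]        ++ q = q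
  (x ∷⟨ e ⟩ p) ++ q = x ∷⟨ e ⟩ (p ++ q)

  ∈-++⁻ : ∀ {x y z} (p : Walk x y) {q : Walk y z} v → v ∈ʷ p ++ q → v ∈ʷ p ⊎ v ∈ʷ q
  ∈-++⁻ [ x ]        v v∈        = inj₂ v∈
  ∈-++⁻ (x ∷⟨ e ⟩ p) v (inj₁ v≡x) = inj₁ (inj₁ v≡x)
  ∈-++⁻ (x ∷⟨ e ⟩ p) v (inj₂ v∈)  with ∈-++⁻ p v v∈
  ... | inj₁ v∈p = inj₁ (inj₂ v∈p)
  ... | inj₂ v∈q = inj₂ v∈q

  _▷_ : ∀ {x y z} → Walk x y → y ~ z → Walk x z
  _▷_ {y = y} {z} p e = p ++ y ∷⟨ e ⟩ [ z ]

  ∈-▷⁻ : ∀ {x y z} (p : Walk x y) {e : y ~ z} v → v ∈ʷ p ▷ e → v ∈ʷ p ⊎ v ≡ z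
  ∈-▷⁻ p v v∈ with ∈-++⁻ p v v∈
  ... | inj₁ v∈p          = inj₁ v∈p
  ... | inj₂ (inj₁ refl) = inj₁ (last-∈ʷ p)
  ... | inj₂ (inj₂ v≡z)  = inj₂ v≡z

  reverse : ∀ {x y} → Walk x y → Walk y x
  reverse [ x ]        = [ x ]
  reverse (x ∷⟨ e ⟩ p) = reverse p ▷ ~-sym e

  ∈-reverse⁻ : ∀ {x y} (p : Walk x y) v → v ∈ʷ reverse p → v ∈ʷ p
  ∈-reverse⁻ [ x ]        v v∈ = v∈
  ∈-reverse⁻ (x ∷⟨ e ⟩ p) v v∈ with ∈-▷⁻ (reverse p) v v∈
  ... | inj₁ v∈rp = inj₂ (∈-reverse⁻ p v v∈rp)
  ... | inj₂ v≡x  = inj₁ v≡x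

  data Suffix : ∀ {a x y} → Walk a y → Walk x y → Set where
    here  : ∀ {x y} {p : Walk x y} → Suffix p p
    there : ∀ {a x w y} {r : Walk a y} {p : Walk w y} {e : x ~ w} →
            Suffix r p → Suffix r (x ∷⟨ e ⟩ p)

  Suffix-⊆ : ∀ {a x y} {r : Walk a y} {p : Walk x y} → Suffix r p → r ⊆ʷ p
  Suffix-⊆ here      v v∈ = v∈
  Suffix-⊆ (there s) v v∈ = inj₂ (Suffix-⊆ s v v∈)

  Suffix-AllButLast : ∀ {P : Fin n → Set} {a x y} {r : Walk a y} {p : Walk x y} →
                      Suffix r p → AllButLast P p → AllButLast P r
  Suffix-AllButLast here      Pp       = Pp
  Suffix-AllButLast (there s) (_ , Pp) = Suffix-AllButLast s Pp

  record LastHit (D : Fin n → Set) {x y} (p : Walk x y) : Set where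
    constructor lastHit
    field
      {vertex} : Fin n
      hit      : D vertex
      rest     : Walk vertex y
      suffix   : Suffix rest p
      after    : AllButFirst (¬_ ∘ D) rest

  last-hit : {D : Fin n → Set} → U.Decidable D → ∀ {x y} (p : Walk x y) →
             LastHit D p ⊎ Allʷ (¬_ ∘ D) p
  last-hit D? [ x ] with D? x
  ... | yes Dx = inj₁ (lastHit Dx [ x ] here _)
  ... | no ¬Dx = inj₂ λ { v refl → ¬Dx }
  last-hit D? (x ∷⟨ e ⟩ p) with last-hit D? p
  ... | inj₁ (lastHit Da r s after) = inj₁ (lastHit Da r (there s) after)
  ... | inj₂ ¬Dp with D? x
  ...   | yes Dx = inj₁ (lastHit Dx (x ∷⟨ e ⟩ p) here ¬Dp)
  ...   | no ¬Dx = inj₂ λ { v (inj₁ refl) → ¬Dx ; v (inj₂ v∈p) → ¬Dp v v∈p }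

  record FirstHit (D : Fin n → Set) {x y} (p : Walk x y) : Set where
    constructor firstHit
    field
      {vertex} : Fin n
      hit      : D vertex
      prefix   : Walk x vertex
      within   : prefix ⊆ʷ p
      before   : AllButLast (¬_ ∘ D) prefix

  first-hit : {D : Fin n → Set} → U.Decidable D → ∀ {x y} (p : Walk x y) →
              FirstHit D p ⊎ Allʷ (¬_ ∘ D) p
  first-hit D? [ x ] with D? x
  ... | yes Dx = inj₁ (firstHit Dx [ x ] (λ v v∈ → v∈) _)
  ... | no ¬Dx = inj₂ λ { v refl → ¬Dx }
  first-hit D? (x ∷⟨ e ⟩ p) with D? x
  ... | yes Dx = inj₁ (firstHit Dx [ x ] (λ { v refl → inj₁ refl }) _)
  ... | no ¬Dx with first-hit D? p
  ...   | inj₁ (firstHit Db q q⊆p before) =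
            inj₁ (firstHit Db (x ∷⟨ e ⟩ q) (λ { v (inj₁ v≡x) → inj₁ v≡x ; v (inj₂ v∈q) → inj₂ (q⊆p v v∈q) })
                           (¬Dx , before))
  ...   | inj₂ ¬Dp = inj₂ λ { v (inj₁ refl) → ¬Dx ; v (inj₂ v∈p) → ¬Dp v v∈p }

  Induced : ∀ {x y} → Walk x y → Set
  Induced [ x ]        = ⊤
  Induced (x ∷⟨ e ⟩ p) = Allʷ (_≢ x) p × AllButFirst (λ v → ¬ x ~ v) p × Induced p

  Induced-suffix : ∀ {a x y} {r : Walk a y} {p : Walk x y} → Suffix r p → Induced p → Induced r
  Induced-suffix here      ind           = ind
  Induced-suffix (there s) (_ , _ , ind) = Induced-suffix s ind

  -- Every walk contains an induced path between its ends: recursively shorten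
  -- the tail, then jump from the head to the last tail vertex adjacent to it.
  induced-path : ∀ {x y} (p : Walk x y) → Σ (Walk x y) λ q → Induced q × q ⊆ʷ p
  induced-path [ x ] = [ x ] , _ , λ v v∈ → v∈
  induced-path (x ∷⟨ x~w ⟩ p) with induced-path p
  ... | q , q-ind , q⊆p with last-hit (_≟ x) q
  ...   | inj₁ (lastHit refl r r⊑q _) =
            r , Induced-suffix r⊑q q-ind , λ v v∈r → inj₂ (q⊆p v (Suffix-⊆ r⊑q v v∈r))
  ...   | inj₂ x∉q with last-hit (x ~?_) q
  ...     | inj₂ x≁q = contradiction x~w (x≁q _ (head-∈ʷ q))
  ...     | inj₁ (lastHit x~a r r⊑q after) =
              x ∷⟨ x~a ⟩ r , ((λ v v∈r → x∉q v (Suffix-⊆ r⊑q v v∈r)) , after , Induced-suffix r⊑q q-ind) ,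
              λ { v (inj₁ v≡x) → inj₁ v≡x ; v (inj₂ v∈r) → inj₂ (q⊆p v (Suffix-⊆ r⊑q v v∈r)) }

module ClosingCycles {n : ℕ} (G : Graph n) where
  open Walks G

  vertexAt : ∀ {x y} (p : Walk x y) → Fin (suc (length p)) → Fin n
  vertexAt [ x ]        _       = x
  vertexAt (x ∷⟨ e ⟩ p) zero    = x
  vertexAt (x ∷⟨ e ⟩ p) (suc i) = vertexAt p i

  vertexAt-∈ʷ : ∀ {x y} (p : Walk x y) i → vertexAt p i ∈ʷ p
  vertexAt-∈ʷ [ x ]        _       = refl
  vertexAt-∈ʷ (x ∷⟨ e ⟩ p) zero    = inj₁ refl
  vertexAt-∈ʷ (x ∷⟨ e ⟩ p) (suc i) = inj₂ (vertexAt-∈ʷ p i)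

  vertexAt-first : ∀ {x y} (p : Walk x y) → vertexAt p zero ≡ x
  vertexAt-first [ x ]        = refl
  vertexAt-first (x ∷⟨ e ⟩ p) = refl

  vertexAt-last : ∀ {x y} (p : Walk x y) → vertexAt p (fromℕ (length p)) ≡ y
  vertexAt-last [ x ]        = refl
  vertexAt-last (x ∷⟨ e ⟩ p) = vertexAt-last p

  vertexAt-injective : ∀ {x y} (p : Walk x y) → Induced p → ∀ i j → vertexAt p i ≡ vertexAt p j → i ≡ j
  vertexAt-injective [ x ]        _             zero    zero    _  = refl
  vertexAt-injective (x ∷⟨ e ⟩ p) _             zero    zero    _  = refl
  vertexAt-injective (x ∷⟨ e ⟩ p) (x∉p , _)     zero    (suc j) eq =
    contradiction (≡-sym eq) (x∉p _ (vertexAt-∈ʷ p j))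
  vertexAt-injective (x ∷⟨ e ⟩ p) (x∉p , _)     (suc i) zero    eq =
    contradiction eq (x∉p _ (vertexAt-∈ʷ p i))
  vertexAt-injective (x ∷⟨ e ⟩ p) (_ , _ , ind) (suc i) (suc j) eq =
    cong suc (vertexAt-injective p ind i j eq)

  Consecutive : ∀ {m} → Fin m → Fin m → Set
  Consecutive i j = toℕ j ≡ suc (toℕ i)

  vertexAt-adjacent : ∀ {x y} (p : Walk x y) → Induced p → ∀ i j →
                      vertexAt p i ~ vertexAt p j → Consecutive i j ⊎ Consecutive j i
  vertexAt-adjacent [ x ]        _ zero zero a = contradiction refl (~-irrefl a)
  vertexAt-adjacent (x ∷⟨ e ⟩ p) _ zero zero a = contradiction refl (~-irrefl a)
  vertexAt-adjacent (x ∷⟨ e ⟩ p) _ zero (suc zero) _ = inj₁ refl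
  vertexAt-adjacent (x ∷⟨ e ⟩ w ∷⟨ _ ⟩ q) (_ , x≁q , _) zero (suc (suc j)) a =
    contradiction a (x≁q _ (vertexAt-∈ʷ q j))
  vertexAt-adjacent (x ∷⟨ e ⟩ p) _ (suc zero) zero _ = inj₂ refl
  vertexAt-adjacent (x ∷⟨ e ⟩ w ∷⟨ _ ⟩ q) (_ , x≁q , _) (suc (suc i)) zero a =
    contradiction (~-sym a) (x≁q _ (vertexAt-∈ʷ q i))
  vertexAt-adjacent (x ∷⟨ e ⟩ p) (_ , _ , ind) (suc i) (suc j) a =
    ⊎-map (cong suc) (cong suc) (vertexAt-adjacent p ind i j a)

  consecutive-adjacent : ∀ {x y} (p : Walk x y) i j → Consecutive i j → vertexAt p i ~ vertexAt p j
  consecutive-adjacent [ x ]        zero    zero          ()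
  consecutive-adjacent (x ∷⟨ e ⟩ p) zero    zero          ()
  consecutive-adjacent (x ∷⟨ e ⟩ p) zero    (suc zero)    _ = subst (x ~_) (≡-sym (vertexAt-first p)) e
  consecutive-adjacent (x ∷⟨ e ⟩ p) zero    (suc (suc j)) ()
  consecutive-adjacent (x ∷⟨ e ⟩ p) (suc i) zero          ()
  consecutive-adjacent (x ∷⟨ e ⟩ p) (suc i) (suc j)       c = consecutive-adjacent p i j (ℕP.suc-injective c)

  +1-mod-below : ∀ {K} m → suc m < suc K → (m + 1) % suc K ≡ suc m
  +1-mod-below {K} m m+1<K+1 = trans (cong (_% suc K) (ℕP.+-comm m 1)) (DM.m<n⇒m%n≡m m+1<K+1)

  +1-mod-top : ∀ K → (K + 1) % suc K ≡ 0
  +1-mod-top K = trans (cong (_% suc K) (ℕP.+-comm K 1)) (DM.n%n≡0 (suc K))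

  CycNext-cases : ∀ {K} (i j : Fin (suc K)) → CycNext G i j → Consecutive i j ⊎ (toℕ i ≡ K × toℕ j ≡ 0)
  CycNext-cases {K} i j j≡ with ℕP.m≤n⇒m<n∨m≡n (FinP.toℕ<n i)
  ... | inj₁ i+1<K+1 = inj₁ (trans j≡ (+1-mod-below (toℕ i) i+1<K+1))
  ... | inj₂ i+1≡K+1 = inj₂ (i≡K , trans j≡ (trans (cong (λ m → (m + 1) % suc K) i≡K) (+1-mod-top K)))
    where
    i≡K : toℕ i ≡ K
    i≡K = ℕP.suc-injective i+1≡K+1

  CycNext-suc : ∀ {K} (i j : Fin (suc K)) → Consecutive i j → CycNext G i j
  CycNext-suc {K} i j j≡ = trans j≡ (≡-sym (+1-mod-below (toℕ i) (subst (_< suc K) j≡ (FinP.toℕ<n j))))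

  CycNext-wrap : ∀ {K} (i j : Fin (suc K)) → toℕ i ≡ K → toℕ j ≡ 0 → CycNext G i j
  CycNext-wrap {K} i j i≡K j≡0 = trans j≡0 (≡-sym (trans (cong (λ m → (m + 1) % suc K) i≡K) (+1-mod-top K)))

  module ClosingVertex (z : Fin n) {x y : Fin n} (P : Walk x y) (P-ind : Induced P)
                       (z-only : Allʷ (λ v → z ~ v → v ≡ x ⊎ v ≡ y) P) (z∉P : Allʷ (_≢ z) P)
                       (z~x : z ~ x) (z~y : z ~ y) (x≁y : ¬ x ~ y) (x≢y : x ≢ y) where

    cycle : Fin (suc (suc (length P))) → Fin n
    cycle zero    = z
    cycle (suc i) = vertexAt P i

    cycle-injective : Injective _≡_ _≡_ cycle
    cycle-injective {zero}  {zero}  _  = refl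
    cycle-injective {zero}  {suc j} eq = contradiction (≡-sym eq) (z∉P _ (vertexAt-∈ʷ P j))
    cycle-injective {suc i} {zero}  eq = contradiction eq (z∉P _ (vertexAt-∈ʷ P i))
    cycle-injective {suc i} {suc j} eq = cong suc (vertexAt-injective P P-ind i j eq)

    index-of-x : ∀ i → vertexAt P i ≡ x → i ≡ zero
    index-of-x i v≡x = vertexAt-injective P P-ind i zero (trans v≡x (≡-sym (vertexAt-first P)))

    index-of-y : ∀ i → vertexAt P i ≡ y → toℕ i ≡ length P
    index-of-y i v≡y =
      trans (cong toℕ (vertexAt-injective P P-ind i (fromℕ _) (trans v≡y (≡-sym (vertexAt-last P)))))
            (FinP.toℕ-fromℕ _)

    z-adjacent : ∀ i → z ~ vertexAt P i → CycNext G zero (suc i) ⊎ CycNext G (suc i) zero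
    z-adjacent i z~v with z-only _ (vertexAt-∈ʷ P i) z~v
    ... | inj₁ v≡x = inj₁ (CycNext-suc zero (suc i) (cong (suc ∘ toℕ) (index-of-x i v≡x)))
    ... | inj₂ v≡y = inj₂ (CycNext-wrap (suc i) zero (cong suc (index-of-y i v≡y)) refl)

    adjacent⇒CycNext : ∀ i j → cycle i ~ cycle j → CycNext G i j ⊎ CycNext G j i
    adjacent⇒CycNext zero    zero    a = contradiction refl (~-irrefl a)
    adjacent⇒CycNext zero    (suc j) a = z-adjacent j a
    adjacent⇒CycNext (suc i) zero    a = swap (z-adjacent i (~-sym a))
    adjacent⇒CycNext (suc i) (suc j) a =
      ⊎-map (CycNext-suc (suc i) (suc j) ∘ cong suc) (CycNext-suc (suc j) (suc i) ∘ cong suc)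
            (vertexAt-adjacent P P-ind i j a)

    consecutive⇒adjacent : ∀ i j → Consecutive i j → cycle i ~ cycle j
    consecutive⇒adjacent zero    zero          ()
    consecutive⇒adjacent zero    (suc zero)    _ = subst (z ~_) (≡-sym (vertexAt-first P)) z~x
    consecutive⇒adjacent zero    (suc (suc j)) ()
    consecutive⇒adjacent (suc i) zero          ()
    consecutive⇒adjacent (suc i) (suc j)       c = consecutive-adjacent P i j (ℕP.suc-injective c)

    wrap⇒adjacent : ∀ i j → toℕ i ≡ suc (length P) → toℕ j ≡ 0 → cycle i ~ cycle j
    wrap⇒adjacent (suc i) zero i≡ _ =
      subst (_~ z) (≡-sym (trans (cong (vertexAt P) i≡last) (vertexAt-last P))) (~-sym z~y)
      where
      i≡last : i ≡ fromℕ (length P)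
      i≡last = FinP.toℕ-injective (trans (ℕP.suc-injective i≡) (≡-sym (FinP.toℕ-fromℕ _)))

    CycNext⇒adjacent : ∀ i j → CycNext G i j → cycle i ~ cycle j
    CycNext⇒adjacent i j i→j with CycNext-cases i j i→j
    ... | inj₁ c              = consecutive⇒adjacent i j c
    ... | inj₂ (i≡last , j≡0) = wrap⇒adjacent i j i≡last j≡0

    cycle-long : 3 < suc (suc (length P))
    cycle-long = s≤s (s≤s (length-≥2 P x≢y x≁y))

    cycle-induced : InducedCycle G (suc (suc (length P))) cycle
    cycle-induced = cycle-injective , adjacent⇒CycNext ,
      λ { i j (inj₁ i→j) → CycNext⇒adjacent i j i→j ; i j (inj₂ j→i) → ~-sym (CycNext⇒adjacent j i j→i) }

-- In a chordal graph, a vertex z off a walk from x to y that is adjacent to x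
-- and y but to no other vertex of the walk forces x = y or x ~ y: otherwise an
-- induced path inside the walk, closed up by z, is a long induced cycle.
module _ {n : ℕ} (G : Graph n) (chordal : Chordal G) where
  open Walks G
  open ClosingCycles G

  no-chordless-detour : ∀ z {x y} (M : Walk x y) → Allʷ (λ v → z ~ v → v ≡ x ⊎ v ≡ y) M →
                        Allʷ (_≢ z) M → z ~ x → z ~ y → ¬ x ~ y → x ≢ y → ⊥
  no-chordless-detour z M z-only z∉M z~x z~y x≁y x≢y with induced-path M
  ... | P , P-ind , P⊆M = chordal _ cycle-long cycle cycle-induced
    where open ClosingVertex z P P-ind (λ v → z-only v ∘ P⊆M v) (λ v → z∉M v ∘ P⊆M v) z~x z~y x≁y x≢y

-- The connected component C of x in G − K (for x ∉ K), computed as the first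
-- closed stage of repeatedly adding the neighbours outside K.
module Component {n : ℕ} (G : Graph n) (K : Subset n) (x : Fin n) (x∉K : x ∉ K) where
  open Walks G

  NeighbourOutsideK : Subset n → Fin n → Set
  NeighbourOutsideK R w = w ∉ K × ∃ λ v → v ∈ R × v ~ w

  neighbourOutsideK? : ∀ R → U.Decidable (NeighbourOutsideK R)
  neighbourOutsideK? R w = ¬? (w SubP.∈? K) ×-dec FinP.any? (λ v → (v SubP.∈? R) ×-dec (v ~? w))

  open Stages (λ R → select (neighbourOutsideK? R))

  -- Vertices reachable from x in G − K by walks with at most k edges.
  reach : ℕ → Subset n
  reach = stage ⁅ x ⁆

  -- Only the closure property of the stationary stage matters; keeping the
  -- index opaque stops the type checker from computing it.
  opaque
    closedAt : ℕ
    closedAt = proj₁ (stabilises ⁅ x ⁆)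

    reach-closed : select (neighbourOutsideK? (reach closedAt)) ⊆ reach closedAt
    reach-closed = proj₂ (stabilises ⁅ x ⁆)

  C : Subset n
  C = reach closedAt

  x∈C : x ∈ C
  x∈C = stage-⊇ ⁅ x ⁆ closedAt (SubP.x∈⁅x⁆ x)

  reach-avoids-K : ∀ k v → v ∈ reach k → v ∉ K
  reach-avoids-K zero    v v∈ v∈K with SubP.x∈⁅y⁆⇒x≡y x v∈
  ... | refl = x∉K v∈K
  reach-avoids-K (suc k) v v∈ v∈K with SubP.x∈p∪q⁻ (reach k) _ v∈
  ... | inj₁ v∈reach = reach-avoids-K k v v∈reach v∈K
  ... | inj₂ v∈new   = proj₁ (∈-select⁻ (neighbourOutsideK? (reach k)) v∈new) v∈K

  C-avoids-K : ∀ v → v ∈ C → v ∉ K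
  C-avoids-K = reach-avoids-K closedAt

  C-closed : ∀ {v w} → v ∈ C → v ~ w → w ∉ K → w ∈ C
  C-closed v∈C v~w w∉K = reach-closed (∈-select⁺ (neighbourOutsideK? C) (w∉K , _ , v∈C , v~w))

  walk-within-reach : ∀ k v → v ∈ reach k → Σ (Walk x v) (Allʷ (_∈ reach k))
  walk-within-reach zero v v∈ with SubP.x∈⁅y⁆⇒x≡y x v∈
  ... | refl = [ x ] , λ { u refl → SubP.x∈⁅x⁆ x }
  walk-within-reach (suc k) v v∈ with SubP.x∈p∪q⁻ (reach k) _ v∈
  ... | inj₁ v∈reach with walk-within-reach k v v∈reach
  ...   | p , p⊆reach = p , λ u u∈p → SubP.p⊆p∪q _ (p⊆reach u u∈p)
  walk-within-reach (suc k) v v∈ | inj₂ v∈new with ∈-select⁻ (neighbourOutsideK? (reach k)) v∈new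
  ...   | _ , u , u∈reach , u~v with walk-within-reach k u u∈reach
  ...     | p , p⊆reach = p ▷ u~v , within
    where
    within : Allʷ (_∈ reach (suc k)) (p ▷ u~v)
    within w w∈ with ∈-▷⁻ p w w∈
    ... | inj₁ w∈p = SubP.p⊆p∪q _ (p⊆reach w w∈p)
    ... | inj₂ refl = v∈

  walk-from-x : ∀ v → v ∈ C → Σ (Walk x v) (Allʷ (_∈ C))
  walk-from-x = walk-within-reach closedAt

  C-connected : ∀ u v → u ∈ C → v ∈ C → Σ (Walk u v) (Allʷ (_∈ C))
  C-connected u v u∈C v∈C with walk-from-x u u∈C | walk-from-x v v∈C
  ... | p , p⊆C | q , q⊆C = reverse p ++ q , within
    where
    within : Allʷ (_∈ C) (reverse p ++ q)
    within w w∈ with ∈-++⁻ (reverse p) w w∈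
    ... | inj₁ w∈rp = p⊆C w (∈-reverse⁻ p w w∈rp)
    ... | inj₂ w∈q  = q⊆C w w∈q

module CommonNeighbour {n : ℕ} (G : Graph n) (chordal : Chordal G) (C B : Subset n)
    (C-connected : ∀ u v → u ∈ C → v ∈ C → Σ (Walks.Walk G u v) (Walks.Allʷ G (_∈ C)))
    (B-attached : ∀ b → b ∈ B → ∃ λ v → v ∈ C × Walks._~_ G v b)
    (B-clique : IsClique G B)
    (disjoint : ∀ v → v ∈ C → v ∉ B) where
  open Walks G

  NB : Fin n → Subset n
  NB c = B ∩ N G c

  SeesAll : Fin n → Set
  SeesAll c = ∀ b → b ∈ B → c ~ b

  sees-all-or-misses : ∀ c → SeesAll c ⊎ ∃ λ k → k ∈ B × ¬ c ~ k
  sees-all-or-misses c with B SubP.⊆? N G c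
  ... | yes B⊆Nc = inj₁ λ b b∈B → ∈-tabulate⁻ (B⊆Nc b∈B)
  ... | no  B⊈Nc with ⊈-witness (N G c) B B⊈Nc
  ...   | k , k∈B , k∉Nc = inj₂ (k , k∈B , k∉Nc ∘ ∈-tabulate⁺)

  -- Let q run inside C from c to b, where b is the first vertex of q adjacent
  -- to k₁ ∈ B, and c ≁ k₁.  Then every neighbour k ∈ B of c is a neighbour of
  -- b: otherwise, with a the last vertex of q adjacent to k, the rest of q from
  -- a to b followed by k₁ is a walk around which k is a chordless detour.
  keeps-neighbours : ∀ {c b k₁ k} (q : Walk c b) → Allʷ (_∈ C) q → AllButLast (λ v → ¬ v ~ k₁) q →
                     b ~ k₁ → k₁ ∈ B → k ∈ B → c ~ k → ¬ c ~ k₁ → b ~ k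
  keeps-neighbours {c} {b} {k₁} {k} q q⊆C before b~k₁ k₁∈B k∈B c~k c≁k₁ with b ~? k
  ... | yes b~k = b~k
  ... | no  b≁k with last-hit (_~? k) q
  ...   | inj₂ q≁k = contradiction c~k (q≁k c (head-∈ʷ q))
  ...   | inj₁ (lastHit {a} a~k r r⊑q after) =
            ⊥-elim (no-chordless-detour G chordal k (r ▷ b~k₁) k-only k∉M
                      (~-sym a~k) (B-clique k k₁ k∈B k₁∈B k≢k₁) a≁k₁ a≢k₁)
    where
    r⊆C : Allʷ (_∈ C) r
    r⊆C v v∈r = q⊆C v (Suffix-⊆ r⊑q v v∈r)

    k≢k₁ : k ≢ k₁
    k≢k₁ refl = c≁k₁ c~k

    a≢k₁ : a ≢ k₁
    a≢k₁ refl = disjoint a (r⊆C a (head-∈ʷ r)) k₁∈B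

    a≁k₁ : ¬ a ~ k₁
    a≁k₁ = AllButLast-head r (Suffix-AllButLast r⊑q before) λ { refl → b≁k a~k }

    k-only : Allʷ (λ v → k ~ v → v ≡ a ⊎ v ≡ k₁) (r ▷ b~k₁)
    k-only v v∈ k~v with ∈-▷⁻ r v v∈ | v ≟ a
    ... | inj₂ v≡k₁ | _       = inj₂ v≡k₁
    ... | inj₁ _    | yes v≡a = inj₁ v≡a
    ... | inj₁ v∈r  | no  v≢a = contradiction (~-sym k~v) (AllButFirst-use r after v v∈r v≢a)

    k∉M : Allʷ (_≢ k) (r ▷ b~k₁)
    k∉M v v∈ refl with ∈-▷⁻ r v v∈
    ... | inj₁ v∈r  = disjoint v (r⊆C v v∈r) k∈B
    ... | inj₂ v≡k₁ = k≢k₁ v≡k₁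

  -- A vertex of C missing k₁ ∈ B: walking inside C towards a neighbour of k₁
  -- reaches a vertex b that keeps all neighbours in B and gains k₁.
  improve : ∀ c → c ∈ C → ∀ k₁ → k₁ ∈ B → ¬ c ~ k₁ → ∃ λ b → b ∈ C × ∣ NB c ∣ < ∣ NB b ∣
  improve c c∈C k₁ k₁∈B c≁k₁ with B-attached k₁ k₁∈B
  ... | d , d∈C , d~k₁ with C-connected c d c∈C d∈C
  ...   | w , w⊆C with first-hit (_~? k₁) w
  ...     | inj₂ w≁k₁ = contradiction d~k₁ (w≁k₁ d (last-∈ʷ w))
  ...     | inj₁ (firstHit {b} b~k₁ q q⊆w before) =
              b , q⊆C b (last-∈ʷ q) , SubP.p⊂q⇒∣p∣<∣q∣ (NBc⊆NBb , k₁ , k₁∈NBb , k₁∉NBc)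
    where
    q⊆C : Allʷ (_∈ C) q
    q⊆C v v∈q = w⊆C v (q⊆w v v∈q)

    NBc⊆NBb : NB c ⊆ NB b
    NBc⊆NBb k∈ with SubP.x∈p∩q⁻ B (N G c) k∈
    ... | k∈B , k∈Nc =
      SubP.x∈p∩q⁺ (k∈B , ∈-tabulate⁺ (keeps-neighbours q q⊆C before b~k₁ k₁∈B k∈B (∈-tabulate⁻ k∈Nc) c≁k₁))

    k₁∈NBb : k₁ ∈ NB b
    k₁∈NBb = SubP.x∈p∩q⁺ (k₁∈B , ∈-tabulate⁺ b~k₁)

    k₁∉NBc : k₁ ∉ NB c
    k₁∉NBc k₁∈ = c≁k₁ (∈-tabulate⁻ (proj₂ (SubP.x∈p∩q⁻ B (N G c) k₁∈)))

  sees-all-within : ∀ m c → c ∈ C → ∣ B ∣ ≤ ∣ NB c ∣ + m → ∃ λ c′ → c′ ∈ C × SeesAll c′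
  sees-all-within m c c∈C bound with sees-all-or-misses c
  ... | inj₁ sees = c , c∈C , sees
  ... | inj₂ (k₁ , k₁∈B , c≁k₁) with improve c c∈C k₁ k₁∈B c≁k₁
  ...   | b , b∈C , more with m
  ...     | zero   = contradiction exhausted (ℕP.<-irrefl refl)
    where
    open ℕP.≤-Reasoning
    exhausted : ∣ NB c ∣ < ∣ NB c ∣
    exhausted = begin-strict
      ∣ NB c ∣     <⟨ more ⟩
      ∣ NB b ∣     ≤⟨ SubP.∣p∩q∣≤∣p∣ B (N G b) ⟩
      ∣ B ∣        ≤⟨ bound ⟩
      ∣ NB c ∣ + 0 ≡⟨ ℕP.+-identityʳ _ ⟩
      ∣ NB c ∣     ∎
  ...     | suc m′ = sees-all-within m′ b b∈C bound′
    where
    open ℕP.≤-Reasoning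
    bound′ : ∣ B ∣ ≤ ∣ NB b ∣ + m′
    bound′ = begin
      ∣ B ∣                ≤⟨ bound ⟩
      ∣ NB c ∣ + suc m′    ≡⟨ ℕP.+-suc _ m′ ⟩
      suc (∣ NB c ∣ + m′)  ≤⟨ ℕP.+-monoˡ-≤ m′ more ⟩
      ∣ NB b ∣ + m′        ∎

  common-neighbour : ∀ c → c ∈ C → ∃ λ c′ → c′ ∈ C × SeesAll c′
  common-neighbour c c∈C = sees-all-within ∣ B ∣ c c∈C (ℕP.m≤n+m ∣ B ∣ ∣ NB c ∣)

θ-Closed : ∀ {n} → Graph n → (Fin n → ℤ) → Subset n → Set
θ-Closed G θ A = ∀ u → θ u ≤ℤ + ∣ N G u ∩ A ∣ → u ∈ A

module ClosedSets {n : ℕ} (G : Graph n) (chordal : Chordal G) (t : ℕ) (connected : Connected G t)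
                  (θ : Fin n → ℤ) (θ≤t : ∀ v → θ v ≤ℤ + t) (A : Subset n) (A-closed : θ-Closed G θ A)
                  (x : Fin n) (x∉A : x ∉ A) where
  open Walks G

  module Shrink (K : Subset n) (K-clique : IsClique G K) (K⊆A : K ⊆ A) (t≤K : t ≤ ∣ K ∣) (x∉K : x ∉ K) where
    open Component G K x x∉K

    Attached : Fin n → Set
    Attached k = k ∈ K × ∃ λ v → v ∈ C × v ~ k

    attached? : U.Decidable Attached
    attached? k = (k SubP.∈? K) ×-dec FinP.any? (λ v → (v SubP.∈? C) ×-dec (v ~? k))

    B : Subset n
    B = select attached?

    B⊆K : B ⊆ K
    B⊆K b∈B = proj₁ (∈-select⁻ attached? b∈B)

    C∩B=∅ : ∀ v → v ∈ C → v ∉ B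
    C∩B=∅ v v∈C v∈B = C-avoids-K v v∈C (B⊆K v∈B)

    -- A walk avoiding B that starts in C never leaves C: its first vertex
    -- outside C would be a vertex of K attached to C.
    stays-in-C : ∀ {u v} (p : Walk u v) → Allʷ (_∉ B) p → u ∈ C → v ∈ C
    stays-in-C [ u ]            _   u∈C = u∈C
    stays-in-C (u ∷⟨ u~w ⟩ p) p∉B u∈C with _ SubP.∈? K
    ... | yes w∈K = contradiction (∈-select⁺ attached? (w∈K , u , u∈C , u~w)) (p∉B _ (inj₂ (head-∈ʷ p)))
    ... | no  w∉K = stays-in-C p (λ v v∈p → p∉B v (inj₂ v∈p)) (C-closed u∈C u~w w∉K)

    -- B separates C from K ∖ B, so by t-connectivity it has at least t vertices.
    B-large : t ≤ ∣ B ∣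
    B-large with K SubP.⊆? B
    ... | yes K⊆B = ℕP.≤-trans t≤K (SubP.p⊆q⇒∣p∣≤∣q∣ K⊆B)
    ... | no  K⊈B with ⊈-witness B K K⊈B | t ℕP.≤? ∣ B ∣
    ...   | _           | yes t≤B = t≤B
    ...   | k , k∈K , k∉B | no  t≰B
      with PathAvoiding⇒Walk (proj₂ connected B (ℕP.≰⇒> t≰B) x k (C∩B=∅ x x∈C) k∉B)
    ...     | p , p∉B = contradiction k∈K (C-avoids-K k (stays-in-C p p∉B x∈C))

    open CommonNeighbour G chordal C B C-connected (λ b b∈B → proj₂ (∈-select⁻ attached? b∈B))
                         (λ u v u∈B v∈B → K-clique u v (B⊆K u∈B) (B⊆K v∈B)) C∩B=∅

    -- The common neighbour c is kept opaque for the same reason as closedAt.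
    opaque
      c : Fin n
      c = proj₁ (common-neighbour x x∈C)

      c∈C : c ∈ C
      c∈C = proj₁ (proj₂ (common-neighbour x x∈C))

      c~B : SeesAll c
      c~B = proj₂ (proj₂ (common-neighbour x x∈C))

    -- c is adjacent to all of B ⊆ A and |B| ≥ t ≥ θ(c), so c ∈ A by closedness.
    c∈A : c ∈ A
    c∈A = A-closed c (ℤP.≤-trans (θ≤t c) (+≤+ (ℕP.≤-trans B-large (SubP.p⊆q⇒∣p∣≤∣q∣ B⊆N∩A))))
      where
      B⊆N∩A : B ⊆ N G c ∩ A
      B⊆N∩A {b} b∈B = SubP.x∈p∩q⁺ (∈-tabulate⁺ (c~B b b∈B) , K⊆A (B⊆K b∈B))

    K′ : Subset n
    K′ = B ∪ ⁅ c ⁆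

    K′-clique : IsClique G K′
    K′-clique = IsClique-extend (λ u v u∈B v∈B → K-clique u v (B⊆K u∈B) (B⊆K v∈B)) c~B

    K′⊆A : K′ ⊆ A
    K′⊆A = ∪⁅⁆-⊆ (K⊆A ∘ B⊆K) c∈A

    t≤K′ : t ≤ ∣ K′ ∣
    t≤K′ = ℕP.≤-trans B-large (SubP.∣p∣≤∣p∪q∣ B ⁅ c ⁆)

    x∉K′ : x ∉ K′
    x∉K′ = ∉-∪⁅⁆ (C∩B=∅ x x∈C) λ x≡c → x∉A (subst (_∈ A) (≡-sym x≡c) c∈A)

    -- The component of x in G − K′ lies inside C and misses c ∈ C.
    smaller : ∣ Component.C G K′ x x∉K′ ∣ < ∣ C ∣
    smaller = SubP.p⊂q⇒∣p∣<∣q∣ (C′⊆C , c , c∈C , λ c∈C′ → Component.C-avoids-K G K′ x x∉K′ c c∈C′ c∈K′)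
      where
      c∈K′ : c ∈ K′
      c∈K′ = SubP.q⊆p∪q B ⁅ c ⁆ (SubP.x∈⁅x⁆ c)

      C′⊆C : Component.C G K′ x x∉K′ ⊆ C
      C′⊆C {v} v∈C′ with Component.walk-from-x G K′ x x∉K′ v v∈C′
      ... | p , p⊆C′ = stays-in-C p (λ u u∈p u∈B →
              Component.C-avoids-K G K′ x x∉K′ u (p⊆C′ u u∈p) (SubP.p⊆p∪q ⁅ c ⁆ u∈B)) x∈C

  -- Each step strictly shrinks the component of x, so no such clique exists.
  no-large-clique : ∀ m (K : Subset n) → IsClique G K → K ⊆ A → t ≤ ∣ K ∣ → (x∉K : x ∉ K) →
                    ∣ Component.C G K x x∉K ∣ < m → ⊥
  no-large-clique zero    K _        _   _   _   ()
  no-large-clique (suc m) K K-clique K⊆A t≤K x∉K bound =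
    no-large-clique m K′ K′-clique K′⊆A t≤K′ x∉K′ (ℕP.<-≤-trans smaller (ℕP.≤-pred bound))
    where open Shrink K K-clique K⊆A t≤K x∉K

closed-set-is-everything : ∀ {n} (G : Graph n) → Chordal G → (t : ℕ) → Connected G t →
  (θ : Fin n → ℤ) → (∀ v → θ v ≤ℤ + t) → (A : Subset n) → θ-Closed G θ A →
  (K : Subset n) → IsClique G K → K ⊆ A → t ≤ ∣ K ∣ → ∀ x → x ∈ A
closed-set-is-everything G chordal t connected θ θ≤t A A-closed K K-clique K⊆A t≤K x with x SubP.∈? A
... | yes x∈A = x∈A
... | no  x∉A = ⊥-elim (ClosedSets.no-large-clique G chordal t connected θ θ≤t A A-closed x x∉A
                          (suc ∣ Component.C G K x x∉K ∣) K K-clique K⊆A t≤K x∉K ℕP.≤-refl)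
  where
  x∉K : x ∉ K
  x∉K = x∉A ∘ K⊆A

-- The activation process is the stage sequence of the activation step, so it
-- reaches a θ-closed active set containing S.
module Activation {n : ℕ} (G : Graph n) (θ : Fin n → ℤ) (S : Subset n) where

  activation-step : Subset n → Subset n
  activation-step A = select (λ u → θ u ℤ.≤? + ∣ N G u ∩ A ∣)

  open Stages activation-step

  active≡stage : ∀ k → active G θ S k ≡ stage S k
  active≡stage zero    = refl
  active≡stage (suc k) = cong (λ A → A ∪ activation-step A) (active≡stage k)

  final-active-set : ∃ λ k → θ-Closed G θ (active G θ S k) × S ⊆ active G θ S k
  final-active-set with stabilises S
  ... | k , closed = k , active-closed , S⊆active
    where
    active-closed : θ-Closed G θ (active G θ S k)
    active-closed u θu≤ rewrite active≡stage k =
      closed (∈-select⁺ (λ u → θ u ℤ.≤? + ∣ N G u ∩ stage S k ∣) θu≤)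

    S⊆active : S ⊆ active G θ S k
    S⊆active rewrite active≡stage k = stage-⊇ S k

-- Lemma 8.
lemma8 : ∀ (n t : ℕ) → 2 ≤ t → (G : Graph n) → Connected G t → Chordal G →
           (θ : Fin n → ℤ) → (∀ x → θ x ≤ℤ + t) →
           (S : Subset n) → IsClique G S → ∣ S ∣ ≡ t →
           Influences G θ S
lemma8 n t _ G connected chordal θ θ≤t S S-clique ∣S∣≡t v with Activation.final-active-set G θ S
... | k , closed , S⊆active =
  k , closed-set-is-everything G chordal t connected θ θ≤t (active G θ S k) closed
        S S-clique S⊆active (ℕP.≤-reflexive (≡-sym ∣S∣≡t)) v
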